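{- A permutation is separable if and only if it does not contain any sub-pattern which is simultaneously diverging and irreducible.
   Context: A pattern of size $\ell$ is a function $p:[\ell]^2\to2$ ($[\ell]^2$ = pairs $i<j<\ell$). A permutation $\pi$ of $\{0,\dots,\ell-1\}$ is identified with the pattern $p_\pi(x,y)=0$ if $\pi(x)<\pi(y)$, $1$ otherwise. A sub-pattern of $p$ is the pattern obtained by restricting $p$ to a subset $\{i_0<\dots<i_{m-1}\}$ of $\{0,\dots,\ell-1\}$ and reindexing, i.e. $q(a,b)=p(i_a,i_b)$. Join: for patterns $p,q$, $p\uplus q$ is the pattern of size $|p|+|q|-1$ with $(p\uplus q)(x,y)=p(x,y)$ if $y<|p|$; $=q(x-|p|+1,y-|p|+1)$ if $x\ge|p|-1$; $=p(x,|p|-1)$ if $x<|p|-1<y$. A pattern is reducible if it equals $p_0\uplus p_1$ for patterns $p_0,p_1$ of size at least $2$, irreducible otherwise. For a pattern $p$ of size $\ell$ and $c<2$, $p\rhd c$ is the pattern of size $\ell+1$ extending $p$ with $(p\rhd c)(x,\ell)=c$ for $x<\ell$. A pattern is convergent if it is of the form $p\rhd c$, and diverging otherwise. Direct sum $(\pi\oplus\sigma)(x)=\pi(x)$ for $x<m$, $\sigma(x-m)+m$ otherwise; skew sum $(\pi\ominus\sigma)(x)=\pi(x)+n$ for $x<m$, $\sigma(x-m)$ otherwise ($m,n$ sizes of $\pi,\sigma$). A permutation is separable if obtained from the one-element permutation by direct and skew sums. -}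

module Defs where

open import Data.Nat using (ℕ; zero; suc; _+_; _∸_; _≤_; _<_; _<ᵇ_; _≡ᵇ_)
open import Data.Nat.Properties using (_<?_)
open import Data.Fin using (Fin; toℕ; fromℕ<)
import Data.Fin.Properties as FinP
open import Data.Fin.Permutation using (Permutation′; _⟨$⟩ʳ_)
open import Data.Bool using (Bool; true; false; if_then_else_; not)
open import Data.Product using (Σ; ∃; _×_; _,_)
open import Relation.Nullary using (¬_; yes; no)
open import Relation.Nullary.Decidable using (⌊_⌋)
open import Relation.Binary.PropositionalEquality using (_≡_)

-- A pattern of size ℓ: a function on pairs (i , j) with i < j < ℓ.
-- Represented by a total function ℕ → ℕ → Bool; only values at
-- i < j < size are meaningful (see _≈P_).
record Pattern : Set where
  constructor pat
  field
    size : ℕ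
    at   : ℕ → ℕ → Bool
open Pattern public

_≈P_ : Pattern → Pattern → Set
p ≈P q = size p ≡ size q × (∀ i j → i < j → j < size p → at p i j ≡ at q i j)

-- pattern of a permutation: p(x,y) = 0 (false) iff π(x) < π(y)
permPat : ∀ {ℓ} → Permutation′ ℓ → Pattern
permPat {ℓ} π = pat ℓ f
  where
  f : ℕ → ℕ → Bool
  f x y with x <? ℓ | y <? ℓ
  ... | yes x<ℓ | yes y<ℓ =
        not ⌊ toℕ (π ⟨$⟩ʳ fromℕ< x<ℓ) <? toℕ (π ⟨$⟩ʳ fromℕ< y<ℓ) ⌋
  ... | _ | _ = false

SubPattern : Pattern → Pattern → Set
SubPattern q p =
  Σ (ℕ → ℕ) λ ι →
    (∀ a b → a < b → b < size q → ι a < ι b) ×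
    (∀ a → a < size q → ι a < size p) ×
    (q ≈P pat (size q) (λ a b → at p (ι a) (ι b)))

join : Pattern → Pattern → Pattern
join p q = pat (size p + size q ∸ 1) f
  where
  f : ℕ → ℕ → Bool
  f x y = if y <ᵇ size p then at p x y
          else if (size p ∸ 1) <ᵇ suc x
               then at q (x ∸ (size p ∸ 1)) (y ∸ (size p ∸ 1))
               else at p x (size p ∸ 1)

Reducible : Pattern → Set
Reducible p = Σ Pattern λ p₀ → Σ Pattern λ p₁ →
  2 ≤ size p₀ × 2 ≤ size p₁ × p ≈P join p₀ p₁

Irreducible : Pattern → Set
Irreducible p = ¬ Reducible p

_▷_ : Pattern → Bool → Pattern
p ▷ c = pat (suc (size p)) (λ x y → if y ≡ᵇ size p then c else at p x y)

Convergent : Pattern → Set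
Convergent p = Σ Pattern λ q → Σ Bool λ c → p ≈P (q ▷ c)

Diverging : Pattern → Set
Diverging p = ¬ Convergent p

-- separability, on permutations given as functions ℕ → ℕ (values outside
-- the domain {0..n-1} are irrelevant)
data Sep : ℕ → (ℕ → ℕ) → Set where
  one  : ∀ {f} → f 0 ≡ 0 → Sep 1 f
  dsum : ∀ {m n f g h} → Sep m f → Sep n g →
         (∀ x → x < m → h x ≡ f x) →
         (∀ x → m ≤ x → x < m + n → h x ≡ g (x ∸ m) + m) →
         Sep (m + n) h
  ssum : ∀ {m n f g h} → Sep m f → Sep n g →
         (∀ x → x < m → h x ≡ f x + n) →
         (∀ x → m ≤ x → x < m + n → h x ≡ g (x ∸ m)) →
         Sep (m + n) h

permFun : ∀ {ℓ} → Permutation′ ℓ → ℕ → ℕ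
permFun {ℓ} π x with x <? ℓ
... | yes x<ℓ = toℕ (π ⟨$⟩ʳ fromℕ< x<ℓ)
... | no _ = 0

Separable : ∀ {ℓ} → Permutation′ ℓ → Set
Separable {ℓ} π = Sep ℓ (permFun π)

-- If π is separable, a subsequence of π of length ≥ 2 either lies inside one summand of the
-- direct or skew sum building π, or is cut by that sum into a prefix lying entirely below
-- (or entirely above) the remaining suffix.  So every sub-pattern of size ≥ 2 is constant
-- across some position k: it is convergent if k is its last position and the join at k
-- otherwise.
--
-- Conversely, by induction on the length, every permutation of length ≥ 2 splits as a direct
-- or skew sum or contains 3142 or 2413.  A split of all entries but the last one extends to
-- the whole permutation, or the last entry alone splits off, unless the last entry lies
-- between two entries of the prefix before the split point; then the induction hypothesis
-- for that prefix followed by the last entry yields a split or an occurrence of 3142.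
-- By pigeonhole the two blocks of a split are again permutations, and 3142 and 2413 are
-- diverging irreducible patterns.
module Submission where

open import Defs
open import Data.Nat using (ℕ; zero; suc; _+_; _∸_; _≤_; _<_; _<ᵇ_; _≡ᵇ_; z≤n; s≤s; z<s; s<s; s≤s⁻¹)
open import Data.Nat.Properties
open import Data.Nat.Induction using (<-wellFounded)
open import Induction.WellFounded using (Acc; acc)
open import Data.Fin using (Fin; toℕ; fromℕ<)
import Data.Fin.Properties as Fin
open import Data.Fin.Permutation using (Permutation′; _⟨$⟩ʳ_; _⟨$⟩ˡ_; inverseˡ)
open import Data.Bool using (Bool; true; false; not; if_then_else_)
open import Data.Bool.Properties using (T-≡; not-injective)
open import Data.Product using (Σ; ∃; _×_; _,_; proj₁; proj₂)
open import Data.Sum using (_⊎_; inj₁; inj₂; [_,_]′; swap)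
import Data.Sum as Sum
open import Data.Empty using (⊥-elim)
open import Function using (_∘_; flip)
open import Function.Bundles using (_⇔_; mk⇔; Equivalence)
open import Relation.Binary using (IsStrictTotalOrder; Transitive; tri<; tri≈; tri>)
import Relation.Binary.Construct.Flip.EqAndOrd as Flip
open import Relation.Nullary using (¬_; yes; no; Dec)
open import Relation.Nullary.Decidable using (⌊_⌋; isYes≗does; dec-true; dec-false)
open import Relation.Binary.PropositionalEquality
open import Level using (0ℓ)
open import Effect.Applicative using (RawApplicative)
open import Data.Sum.Effectful.Right using (applicative)

InjectiveOn : (ℕ → ℕ) → ℕ → Set
InjectiveOn h n = ∀ x y → x < n → y < n → h x ≡ h y → x ≡ y

StrictMonoOn : (ℕ → ℕ) → ℕ → Set
StrictMonoOn ι m = ∀ a b → a < b → b < m → ι a < ι b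

record IsPermutationOn (ℓ : ℕ) (h : ℕ → ℕ) : Set where
  field
    bounded   : ∀ x → x < ℓ → h x < ℓ
    injective : InjectiveOn h ℓ

m<n+o⇒m∸n<o′ : ∀ {m n o} → n ≤ m → m < n + o → m ∸ n < o
m<n+o⇒m∸n<o′ {m} {n} {o} n≤m m<n+o = subst (m ∸ n <_) (m+n∸m≡n n o) (∸-monoˡ-< m<n+o n≤m)

∸-monoˡ-<⁻¹ : ∀ {m n o} → o ≤ m → o ≤ n → m ∸ o < n ∸ o → m < n
∸-monoˡ-<⁻¹ {o = o} o≤m o≤n lt = subst₂ _<_ (m∸n+n≡m o≤m) (m∸n+n≡m o≤n) (+-monoˡ-< o lt)

least-or-none : ∀ {P : ℕ → Set} → (∀ x → Dec (P x)) → ∀ n →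
  (∀ x → x < n → ¬ P x) ⊎ ∃ λ k → k < n × P k × (∀ x → x < k → ¬ P x)
least-or-none P? zero = inj₁ λ _ ()
least-or-none {P} P? (suc n) with least-or-none P? n
... | inj₂ (k , k<n , Pk , below) = inj₂ (k , m<n⇒m<1+n k<n , Pk , below)
... | inj₁ none with P? n
...   | yes Pn = inj₂ (n , ≤-refl , Pn , none)
...   | no ¬Pn = inj₁ none′
  where
  none′ : ∀ x → x < suc n → ¬ P x
  none′ x x<1+n with m<1+n⇒m<n∨m≡n x<1+n
  ... | inj₁ x<n = none x x<n
  ... | inj₂ refl = ¬Pn

pigeonhole : ∀ {m n φ} → (∀ i → i < m → φ i < n) → InjectiveOn φ m → m ≤ n
pigeonhole {m} {n} {φ} φ<n φ-inj = Fin.injective⇒≤ φ′-inj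
  where
  φ′ : Fin m → Fin n
  φ′ i = fromℕ< (φ<n (toℕ i) (Fin.toℕ<n i))
  φ′-inj : ∀ {i j} → φ′ i ≡ φ′ j → i ≡ j
  φ′-inj {i} {j} e = Fin.toℕ-injective
    (φ-inj _ _ (Fin.toℕ<n i) (Fin.toℕ<n j) (Fin.fromℕ<-injective _ _ _ _ e))

below-distinct⇒< : ∀ {m n v φ} → InjectiveOn φ m →
  (∀ i → i < m → v < φ i × φ i < m + n) → v < m + n → v < n
below-distinct⇒< {m} {n} {v} {φ} φ-inj range v<m+n = +-cancelˡ-≤ m _ _ (begin
  m + suc v               ≤⟨ +-monoˡ-≤ (suc v) m≤rest ⟩
  (m + n ∸ suc v) + suc v ≡⟨ m∸n+n≡m v<m+n ⟩
  m + n                   ∎)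
  where
  open ≤-Reasoning
  m≤rest : m ≤ m + n ∸ suc v
  m≤rest = pigeonhole
    (λ i i<m → ∸-monoˡ-< (proj₂ (range i i<m)) (proj₁ (range i i<m)))
    (λ i j i<m j<m e → φ-inj i j i<m j<m
      (∸-cancelʳ-≡ (proj₁ (range i i<m)) (proj₁ (range j j<m)) e))

strictMonoOn-suc : ∀ {ι m} → (∀ i → suc i < m → ι i < ι (suc i)) → StrictMonoOn ι m
strictMonoOn-suc step a (suc b) a<1+b 1+b<m with m<1+n⇒m<n∨m≡n a<1+b
... | inj₁ a<b = <-trans (strictMonoOn-suc step a b a<b (<-trans (n<1+n b) 1+b<m)) (step b 1+b<m)
... | inj₂ refl = step b 1+b<m

strictMonoOn⇒monoOn : ∀ {ι m} → StrictMonoOn ι m → ∀ a b → a ≤ b → b < m → ι a ≤ ι b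
strictMonoOn⇒monoOn mono a b a≤b b<m with m≤n⇒m<n∨m≡n a≤b
... | inj₁ a<b = <⇒≤ (mono a b a<b b<m)
... | inj₂ refl = ≤-refl

strictMonoOn-bounded : ∀ {ι m ℓ} → StrictMonoOn ι (suc m) → ι m < ℓ → ∀ i → i < suc m → ι i < ℓ
strictMonoOn-bounded {ι} {m} mono ιm<ℓ i i<1+m =
  ≤-<-trans (strictMonoOn⇒monoOn mono i m (s≤s⁻¹ i<1+m) ≤-refl) ιm<ℓ

strictMonoOn⇒injectiveOn : ∀ {ι m} → StrictMonoOn ι m → InjectiveOn ι m
strictMonoOn⇒injectiveOn mono x y x<m y<m e with <-cmp x y
... | tri< x<y _ _ = ⊥-elim (<-irrefl e (mono x y x<y y<m))
... | tri≈ _ x≡y _ = x≡y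
... | tri> _ _ y<x = ⊥-elim (<-irrefl (sym e) (mono y x y<x x<m))

injectiveOn-∘ : ∀ {h ℓ ι m} → InjectiveOn h ℓ → StrictMonoOn ι m → (∀ x → x < m → ι x < ℓ) →
  InjectiveOn (h ∘ ι) m
injectiveOn-∘ h-inj mono bnd x y x<m y<m e =
  strictMonoOn⇒injectiveOn mono x y x<m y<m (h-inj _ _ (bnd x x<m) (bnd y y<m) e)

SplitsAt : (ℕ → ℕ → Set) → (ℕ → ℕ) → ℕ → ℕ → Set
SplitsAt _≺_ h n k = ∀ x y → x < k → k ≤ y → y < n → h x ≺ h y

Decomposable : (ℕ → ℕ → Set) → (ℕ → ℕ) → ℕ → Set
Decomposable _≺_ h n = ∃ λ k → 1 ≤ k × k < n × (SplitsAt _≺_ h n k ⊎ SplitsAt (flip _≺_) h n k)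

Occurs3142 : (ℕ → ℕ → Set) → (ℕ → ℕ) → ℕ → Set
Occurs3142 _≺_ h n = ∃ λ a → ∃ λ b → ∃ λ c → ∃ λ d →
  a < b × b < c × c < d × d < n × h b ≺ h d × h d ≺ h a × h a ≺ h c

-- 3142 read in the reversed order is 2413
Contains2413or3142 : (ℕ → ℕ → Set) → (ℕ → ℕ) → ℕ → Set
Contains2413or3142 _≺_ h n = Occurs3142 _≺_ h n ⊎ Occurs3142 (flip _≺_) h n

DecomposesOrContains : (ℕ → ℕ → Set) → (ℕ → ℕ) → ℕ → Set
DecomposesOrContains _≺_ h n = Decomposable _≺_ h n ⊎ Contains2413or3142 _≺_ h n

DecomposesOrContainsUpTo : (ℕ → ℕ → Set) → ℕ → Set
DecomposesOrContainsUpTo _≺_ n =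
  ∀ {m} → 2 ≤ m → m ≤ n → ∀ {g} → InjectiveOn g m → DecomposesOrContains _≺_ g m

decomposesOrContains-flip : ∀ {_≺_ h n} → DecomposesOrContains (flip _≺_) h n →
  DecomposesOrContains _≺_ h n
decomposesOrContains-flip =
  Sum.map (λ { (k , 1≤k , k<n , split) → k , 1≤k , k<n , swap split }) swap

occurs3142-embed : ∀ {_≺_ g m h n ι} → StrictMonoOn ι m → (∀ a → a < m → ι a < n) →
  (∀ a b → a < m → b < m → g a ≺ g b → h (ι a) ≺ h (ι b)) →
  Occurs3142 _≺_ g m → Occurs3142 _≺_ h n
occurs3142-embed {m = m} {ι = ι} mono bnd pres (a , b , c , d , a<b , b<c , c<d , d<m , bd , da , ac) =
  ι a , ι b , ι c , ι d , mono a b a<b b<m , mono b c b<c c<m , mono c d c<d d<m , bnd d d<m ,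
  pres b d b<m d<m bd , pres d a d<m a<m da , pres a c a<m c<m ac
  where
  c<m : c < m
  c<m = <-trans c<d d<m
  b<m : b < m
  b<m = <-trans b<c c<m
  a<m : a < m
  a<m = <-trans a<b b<m

contains-embed : ∀ {_≺_ g m h n ι} → StrictMonoOn ι m → (∀ a → a < m → ι a < n) →
  (∀ a b → a < m → b < m → g a ≺ g b → h (ι a) ≺ h (ι b)) →
  Contains2413or3142 _≺_ g m → Contains2413or3142 _≺_ h n
contains-embed {_≺_} {g} {h = h} mono bnd pres =
  Sum.map (occurs3142-embed {_≺_} {g} {h = h} mono bnd pres)
          (occurs3142-embed {flip _≺_} {g} {h = h} mono bnd λ a b a<m b<m → pres b a b<m a<m)

splitsAt-two : ∀ {R h} → R (h 0) (h 1) → SplitsAt R h 2 1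
splitsAt-two r zero zero _ () _
splitsAt-two r zero (suc zero) _ _ _ = r
splitsAt-two r zero (suc (suc y)) _ _ (s≤s (s≤s ()))
splitsAt-two r (suc x) _ (s≤s ()) _ _

prefixThen : ℕ → ℕ → ℕ → ℕ
prefixThen k y x with x <? k
... | yes _ = x
... | no _ = y

prefixThen-< : ∀ {k y x} → x < k → prefixThen k y x ≡ x
prefixThen-< {k} {y} {x} x<k with x <? k
... | yes _ = refl
... | no x≮k = ⊥-elim (x≮k x<k)

prefixThen-last : ∀ k y → prefixThen k y k ≡ y
prefixThen-last k y with k <? k
... | yes k<k = ⊥-elim (<-irrefl refl k<k)
... | no _ = refl

prefixThen-strictMono : ∀ {k y} → k ≤ y → StrictMonoOn (prefixThen k y) (suc k)
prefixThen-strictMono {k} {y} k≤y = strictMonoOn-suc step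
  where
  step : ∀ i → suc i < suc k → prefixThen k y i < prefixThen k y (suc i)
  step i (s≤s 1+i≤k) with m≤n⇒m<n∨m≡n 1+i≤k
  ... | inj₁ 1+i<k rewrite prefixThen-< {y = y} (<-trans (n<1+n i) 1+i<k) | prefixThen-< {y = y} 1+i<k =
    n<1+n i
  ... | inj₂ refl rewrite prefixThen-< {y = y} (n<1+n i) | prefixThen-last (suc i) y =
    ≤-trans (n<1+n i) k≤y

prefixThen-bounded : ∀ {k y} → k ≤ y → ∀ x → x < suc k → prefixThen k y x < suc y
prefixThen-bounded {k} {y} k≤y =
  strictMonoOn-bounded (prefixThen-strictMono k≤y) (subst (_< suc y) (sym (prefixThen-last k y)) ≤-refl)

splitsAt-extend : ∀ {R h n k} → SplitsAt R h n k → (∀ x → x < k → R (h x) (h n)) →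
  SplitsAt R h (suc n) k
splitsAt-extend split toLast x y x<k k≤y y<1+n with m<1+n⇒m<n∨m≡n y<1+n
... | inj₁ y<n = split x y x<k k≤y y<n
... | inj₂ refl = toLast x x<k

splitsAt-last : ∀ {R h n} → (∀ x → x < n → R (h x) (h n)) → SplitsAt R h (suc n) n
splitsAt-last {R} {h} =
  splitsAt-extend {R} {h} λ x y x<n n≤y y<n → ⊥-elim (<-irrefl refl (<-≤-trans y<n n≤y))

splitsAt-refine : ∀ {R h n k j} → j ≤ k → (∀ x y → x < j → j ≤ y → y < k → R (h x) (h y)) →
  SplitsAt R h n k → SplitsAt R h n j
splitsAt-refine {k = k} j≤k inner split x y x<j j≤y y<n with y <? k
... | yes y<k = inner x y x<j j≤y y<k
... | no y≮k = split x y (<-≤-trans x<j j≤k) (≮⇒≥ y≮k) y<n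

prefixThen-splitsAt : ∀ {R h k y j} → j ≤ k → SplitsAt R (h ∘ prefixThen k y) (suc k) j →
  (∀ x z → x < j → j ≤ z → z < k → R (h x) (h z)) × (∀ x → x < j → R (h x) (h y))
prefixThen-splitsAt {R} {h} {k} {y} {j} j≤k split = inner , toLast
  where
  fixed : ∀ {x} → x < k → h (prefixThen k y x) ≡ h x
  fixed x<k = cong h (prefixThen-< x<k)
  inner : ∀ x z → x < j → j ≤ z → z < k → R (h x) (h z)
  inner x z x<j j≤z z<k =
    subst₂ R (fixed (<-≤-trans x<j j≤k)) (fixed z<k) (split x z x<j j≤z (m<n⇒m<1+n z<k))
  toLast : ∀ x → x < j → R (h x) (h y)
  toLast x x<j =
    subst₂ R (fixed (<-≤-trans x<j j≤k)) (cong h (prefixThen-last k y)) (split x k x<j j≤k ≤-refl)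

-- An abstract strict total order lets a skew split be handled as a direct split of the reversed order.
module _ {_≺_ : ℕ → ℕ → Set} (≺-sto : IsStrictTotalOrder _≡_ _≺_) where
  open IsStrictTotalOrder ≺-sto
    using (compare) renaming (_<?_ to _≺?_; trans to ≺-trans; irrefl to ≺-irrefl)

  ≺-connex-on : ∀ {h m x y} → InjectiveOn h m → x < m → y < m → x ≢ y → ¬ h x ≺ h y → h y ≺ h x
  ≺-connex-on {h} {x = x} {y} h-inj x<m y<m x≢y x⊀y with compare (h x) (h y)
  ... | tri< x≺y _ _ = ⊥-elim (x⊀y x≺y)
  ... | tri≈ _ e _ = ⊥-elim (x≢y (h-inj x y x<m y<m e))
  ... | tri> _ _ y≺x = y≺x

  prefix-direct : ∀ {n h k a j} → k < n → SplitsAt _≺_ h n k → a < k → h n ≺ h a →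
    (∀ x y → x < j → j ≤ y → y < k → h x ≺ h y) → (∀ x → x < j → h x ≺ h n) → 1 ≤ j →
    Decomposable _≺_ h (suc n)
  prefix-direct {n} {h} {k} {a} {j} k<n split a<k n≺a inner toLast 1≤j with a <? j
  ... | yes a<j = ⊥-elim (≺-irrefl refl (≺-trans n≺a (toLast a a<j)))
  ... | no a≮j = j , 1≤j , m<n⇒m<1+n (<-trans j<k k<n) ,
    inj₁ (splitsAt-extend {_≺_} {h} (splitsAt-refine {_≺_} {h} (<⇒≤ j<k) inner split) toLast)
    where
    j<k : j < k
    j<k = ≤-<-trans (≮⇒≥ a≮j) a<k

  prefix-flipped : ∀ {n h k w j} → k < n → SplitsAt _≺_ h n k → w < k → h w ≺ h n →
    (∀ x → x < j → h n ≺ h x) → 1 ≤ j → Occurs3142 _≺_ h (suc n)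
  prefix-flipped {n} {h} {k} {w} {j} k<n split w<k w≺n fromLast 1≤j with w <? j
  ... | yes w<j = ⊥-elim (≺-irrefl refl (≺-trans w≺n (fromLast w w<j)))
  ... | no w≮j = 0 , w , k , n , 0<w , w<k , k<n , ≤-refl ,
                 w≺n , fromLast 0 1≤j , split 0 k (<-trans 0<w w<k) ≤-refl k<n
    where
    0<w : 0 < w
    0<w = ≤-trans 1≤j (≮⇒≥ w≮j)

  extend-via-prefix : ∀ {n h k a w} →
    DecomposesOrContainsUpTo _≺_ n →
    InjectiveOn h (suc n) → 1 ≤ k → k < n → SplitsAt _≺_ h n k →
    a < k → h n ≺ h a → w < n → h w ≺ h n → DecomposesOrContains _≺_ h (suc n)
  extend-via-prefix {n} {h} {k} {a} {w} ih h-inj 1≤k k<n split a<k n≺a w<n w≺n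
    with ih (s≤s 1≤k) k<n
            (injectiveOn-∘ h-inj (prefixThen-strictMono (<⇒≤ k<n)) (prefixThen-bounded (<⇒≤ k<n)))
  ... | inj₂ c = inj₂ (contains-embed {_≺_} {h ∘ prefixThen k n} {h = h}
                   (prefixThen-strictMono (<⇒≤ k<n)) (prefixThen-bounded (<⇒≤ k<n)) (λ _ _ _ _ p → p) c)
  ... | inj₁ (j , 1≤j , j<1+k , inj₁ s) =
    let inner , toLast = prefixThen-splitsAt {_≺_} {h} (s≤s⁻¹ j<1+k) s in
    inj₁ (prefix-direct k<n split a<k n≺a inner toLast 1≤j)
  ... | inj₁ (j , 1≤j , j<1+k , inj₂ s) =
    let fromLast = proj₂ (prefixThen-splitsAt {flip _≺_} {h} (s≤s⁻¹ j<1+k) s) in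
    inj₂ (inj₁ (prefix-flipped k<n split w<k w≺n fromLast 1≤j))
    where
    w<k : w < k
    w<k with w <? k
    ... | yes w<k = w<k
    ... | no w≮k = ⊥-elim (≺-irrefl refl (≺-trans n≺a (≺-trans (split a w a<k (≮⇒≥ w≮k) w<n) w≺n)))

  extend-split : ∀ {n h k} →
    DecomposesOrContainsUpTo _≺_ n →
    InjectiveOn h (suc n) → 1 ≤ k → k < n → SplitsAt _≺_ h n k → DecomposesOrContains _≺_ h (suc n)
  extend-split {n} {h} {k} ih h-inj 1≤k k<n split with least-or-none (λ x → h n ≺? h x) k
  ... | inj₁ n⊀ = inj₁ (k , 1≤k , m<n⇒m<1+n k<n , inj₁ (splitsAt-extend {_≺_} {h} split below))
    where
    below : ∀ x → x < k → h x ≺ h n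
    below x x<k = ≺-connex-on h-inj ≤-refl (m<n⇒m<1+n x<n) (>⇒≢ x<n) (n⊀ x x<k)
      where
      x<n : x < n
      x<n = <-trans x<k k<n
  ... | inj₂ (a , a<k , n≺a , _) with least-or-none (λ x → h x ≺? h n) n
  ...   | inj₁ ⊀n = inj₁ (n , ≤-trans 1≤k (<⇒≤ k<n) , ≤-refl , inj₂ (splitsAt-last {flip _≺_} {h} above))
    where
    above : ∀ x → x < n → h n ≺ h x
    above x x<n = ≺-connex-on h-inj (m<n⇒m<1+n x<n) ≤-refl (<⇒≢ x<n) (⊀n x x<n)
  ...   | inj₂ (w , w<n , w≺n , _) = extend-via-prefix ih h-inj 1≤k k<n split a<k n≺a w<n w≺n

decomposes-or-contains : ∀ {n} → Acc _<_ n → 2 ≤ n → ∀ {_≺_} → IsStrictTotalOrder _≡_ _≺_ →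
  ∀ {h} → InjectiveOn h n → DecomposesOrContains _≺_ h n
decomposes-or-contains {suc zero} _ (s≤s ())
decomposes-or-contains {suc (suc zero)} _ _ {_≺_} ≺-sto {h} h-inj
  with IsStrictTotalOrder.compare ≺-sto (h 0) (h 1)
... | tri< 0≺1 _ _ = inj₁ (1 , ≤-refl , ≤-refl , inj₁ (splitsAt-two {_≺_} {h} 0≺1))
... | tri≈ _ e _ = ⊥-elim (0≢1+n (h-inj 0 1 z<s ≤-refl e))
... | tri> _ _ 1≺0 = inj₁ (1 , ≤-refl , ≤-refl , inj₂ (splitsAt-two {flip _≺_} {h} 1≺0))
decomposes-or-contains {suc (suc (suc n))} (acc rs) _ {_≺_} ≺-sto {h} h-inj =
  extend (decomposes-or-contains (rs ≤-refl) (s≤s (s≤s z≤n)) ≺-sto h-inj-init)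
  where
  h-inj-init : InjectiveOn h (suc (suc n))
  h-inj-init x y x<n y<n = h-inj x y (m<n⇒m<1+n x<n) (m<n⇒m<1+n y<n)
  ih : ∀ {_⊏_} → IsStrictTotalOrder _≡_ _⊏_ → DecomposesOrContainsUpTo _⊏_ (suc (suc n))
  ih ⊏-sto 2≤m m≤ = decomposes-or-contains (rs (s≤s m≤)) 2≤m ⊏-sto
  extend : DecomposesOrContains _≺_ h (suc (suc n)) → DecomposesOrContains _≺_ h (suc (suc (suc n)))
  extend (inj₂ c) = inj₂ (contains-embed {_≺_} {h} {h = h} {ι = λ x → x}
    (λ _ _ a<b _ → a<b) (λ _ → m<n⇒m<1+n) (λ _ _ _ _ p → p) c)
  extend (inj₁ (k , 1≤k , k<n , inj₁ split)) = extend-split ≺-sto (ih ≺-sto) h-inj 1≤k k<n split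
  extend (inj₁ (k , 1≤k , k<n , inj₂ split)) =
    decomposesOrContains-flip {_≺_} (extend-split ⊁-sto (ih ⊁-sto) h-inj 1≤k k<n split)
    where
    ⊁-sto : IsStrictTotalOrder _≡_ (flip _≺_)
    ⊁-sto = Flip.isStrictTotalOrder ≺-sto

BlockRange : (ℕ → ℕ) → ℕ → ℕ → ℕ → Set
BlockRange h s a len = ∀ i → i < len → a ≤ h (s + i) × h (s + i) < a + len

block : (ℕ → ℕ) → ℕ → ℕ → ℕ → ℕ
block h s a i = h (s + i) ∸ a

block-section : ∀ {h s a len} → BlockRange h s a len → ∀ x → s ≤ x → x < s + len →
  h x ≡ block h s a (x ∸ s) + a
block-section {h} {s} {a} range x s≤x x<s+len = begin
  h x                         ≡⟨ cong h (sym (m+[n∸m]≡n s≤x)) ⟩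
  h (s + (x ∸ s))             ≡⟨ sym (m∸n+n≡m (proj₁ (range (x ∸ s) (m<n+o⇒m∸n<o′ s≤x x<s+len)))) ⟩
  h (s + (x ∸ s)) ∸ a + a     ∎
  where open ≡-Reasoning

module _ {ℓ h s a len} (h-perm : IsPermutationOn ℓ h) (s+len≤ℓ : s + len ≤ ℓ)
         (range : BlockRange h s a len) where
  open IsPermutationOn h-perm

  private
    position< : ∀ i → i < len → s + i < ℓ
    position< i i<len = <-≤-trans (+-monoʳ-< s i<len) s+len≤ℓ

    shift-mono : StrictMonoOn (s +_) len
    shift-mono _ _ i<j _ = +-monoʳ-< s i<j

  block-permutation : IsPermutationOn len (block h s a)
  block-permutation = record { bounded = block-bounded ; injective = block-injective }
    where
    block-bounded : ∀ i → i < len → block h s a i < len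
    block-bounded i i<len =
      m<n+o⇒m∸n<o′ (proj₁ (range i i<len)) (proj₂ (range i i<len))
    block-injective : InjectiveOn (block h s a) len
    block-injective i j i<len j<len e = +-cancelˡ-≡ s i j
      (injective _ _ (position< i i<len) (position< j j<len)
        (∸-cancelʳ-≡ (proj₁ (range i i<len)) (proj₁ (range j j<len)) e))

  block-contains : Contains2413or3142 _<_ (block h s a) len → Contains2413or3142 _<_ h ℓ
  block-contains = contains-embed {_<_} {block h s a} {h = h} shift-mono position<
    λ i j i<len j<len → ∸-monoˡ-<⁻¹ (proj₁ (range i i<len)) (proj₁ (range j j<len))

module _ {k r h} (h-perm : IsPermutationOn (k + r) h) where
  open IsPermutationOn h-perm

  private
    left< : ∀ {x} → x < k → x < k + r
    left< x<k = <-≤-trans x<k (m≤m+n _ r)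

    right< : ∀ {j} → j < r → k + j < k + r
    right< = +-monoʳ-< k

    left-injective : InjectiveOn h k
    left-injective x y x<k y<k = injective x y (left< x<k) (left< y<k)

    right-injective : InjectiveOn (λ j → h (k + j)) r
    right-injective = injectiveOn-∘ injective (λ _ _ i<j _ → +-monoʳ-< k i<j) (λ _ → right<)

    below-r+k : ∀ {x} → x < k + r → h x < r + k
    below-r+k {x} x<k+r = subst (h x <_) (+-comm k r) (bounded x x<k+r)

  direct-blocks : SplitsAt _<_ h (k + r) k → BlockRange h 0 0 k × BlockRange h k k r
  direct-blocks split = left , right
    where
    across : ∀ {i j} → i < k → j < r → h i < h (k + j)
    across {i} {j} i<k j<r = split i (k + j) i<k (m≤m+n k j) (right< j<r)
    left : BlockRange h 0 0 k
    left i i<k = z≤n , below-distinct⇒< right-injective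
      (λ j j<r → across i<k j<r , below-r+k (right< j<r)) (below-r+k (left< i<k))
    right : BlockRange h k k r
    right j j<r = pigeonhole (λ i i<k → across i<k j<r) left-injective , bounded _ (right< j<r)

  skew-blocks : SplitsAt (flip _<_) h (k + r) k → BlockRange h 0 r k × BlockRange h k 0 r
  skew-blocks split = left , right
    where
    across : ∀ {i j} → i < k → j < r → h (k + j) < h i
    across {i} {j} i<k j<r = split i (k + j) i<k (m≤m+n k j) (right< j<r)
    left : BlockRange h 0 r k
    left i i<k = pigeonhole (λ j j<r → across i<k j<r) right-injective , below-r+k (left< i<k)
    right : BlockRange h k 0 r
    right j j<r = z≤n , below-distinct⇒< left-injective
      (λ i i<k → across i<k j<r , bounded i (left< i<k)) (bounded _ (right< j<r))

split-separable-or-contains : ∀ {ℓ k r h} → k + r ≡ ℓ → 1 ≤ k → 1 ≤ r → IsPermutationOn ℓ h →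
  SplitsAt _<_ h ℓ k ⊎ SplitsAt (flip _<_) h ℓ k →
  (∀ {m} → m < ℓ → 1 ≤ m → ∀ {g} → IsPermutationOn m g → Sep m g ⊎ Contains2413or3142 _<_ g m) →
  Sep ℓ h ⊎ Contains2413or3142 _<_ h ℓ
split-separable-or-contains {k = k} {r} {h} refl 1≤k 1≤r h-perm split ih =
  [ from-direct , from-skew ]′ split
  where
  open RawApplicative (applicative 0ℓ (Contains2413or3142 _<_ h (k + r))) using (zipWith)

  piece : ∀ {s a len} → s + len ≤ k + r → len < k + r → 1 ≤ len → BlockRange h s a len →
    Sep len (block h s a) ⊎ Contains2413or3142 _<_ h (k + r)
  piece s+len≤ℓ len<ℓ 1≤len range =
    Sum.map₂ (block-contains h-perm s+len≤ℓ range)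
             (ih len<ℓ 1≤len (block-permutation h-perm s+len≤ℓ range))

  from-direct : SplitsAt _<_ h (k + r) k → Sep (k + r) h ⊎ Contains2413or3142 _<_ h (k + r)
  from-direct direct with direct-blocks h-perm direct
  ... | left , right = zipWith (λ sA sB → dsum sA sB (λ _ _ → refl) (block-section right))
    (piece (m≤m+n k r) (m<m+n k 1≤r) 1≤k left) (piece ≤-refl (m<n+m r 1≤k) 1≤r right)

  from-skew : SplitsAt (flip _<_) h (k + r) k → Sep (k + r) h ⊎ Contains2413or3142 _<_ h (k + r)
  from-skew skew with skew-blocks h-perm skew
  ... | left , right = zipWith
    (λ sA sB → ssum sA sB (λ x x<k → block-section left x z≤n x<k)
                          (λ x k≤x x<ℓ → trans (block-section {h} right x k≤x x<ℓ) (+-identityʳ _)))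
    (piece (m≤m+n k r) (m<m+n k 1≤r) 1≤k left) (piece ≤-refl (m<n+m r 1≤k) 1≤r right)

separable-or-contains : ∀ {ℓ} → Acc _<_ ℓ → 1 ≤ ℓ → ∀ {h} → IsPermutationOn ℓ h →
  Sep ℓ h ⊎ Contains2413or3142 _<_ h ℓ
separable-or-contains {suc zero} _ _ h-perm = inj₁ (one (n<1⇒n≡0 (IsPermutationOn.bounded h-perm 0 z<s)))
separable-or-contains {suc (suc ℓ)} (acc rs) _ h-perm
  with decomposes-or-contains (<-wellFounded _) (s≤s (s≤s z≤n)) <-isStrictTotalOrder
         (IsPermutationOn.injective h-perm)
... | inj₂ c = inj₂ c
... | inj₁ (k , 1≤k , k<ℓ , split) =
  split-separable-or-contains (m+[n∸m]≡n (<⇒≤ k<ℓ)) 1≤k (m<n⇒0<n∸m k<ℓ) h-perm split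
    λ m<ℓ 1≤m → separable-or-contains (rs m<ℓ) 1≤m

sep-bounded : ∀ {ℓ f} → Sep ℓ f → ∀ x → x < ℓ → f x < ℓ
sep-bounded (one f0≡0) zero _ rewrite f0≡0 = z<s
sep-bounded (one _) (suc _) (s≤s ())
sep-bounded (dsum {m} {n} {g = g} sf sg left right) x x<m+n with x <? m
... | yes x<m rewrite left x x<m = <-≤-trans (sep-bounded sf x x<m) (m≤m+n m n)
... | no x≮m rewrite right x (≮⇒≥ x≮m) x<m+n =
  subst (g (x ∸ m) + m <_) (+-comm n m) (+-monoˡ-< m (sep-bounded sg _ (m<n+o⇒m∸n<o′ (≮⇒≥ x≮m) x<m+n)))
sep-bounded (ssum {m} {n} sf sg left right) x x<m+n with x <? m
... | yes x<m rewrite left x x<m = +-monoˡ-< n (sep-bounded sf x x<m)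
... | no x≮m rewrite right x (≮⇒≥ x≮m) x<m+n =
  <-≤-trans (sep-bounded sg _ (m<n+o⇒m∸n<o′ (≮⇒≥ x≮m) x<m+n)) (m≤n+m n m)

SubsequencesDecompose : ℕ → (ℕ → ℕ) → Set
SubsequencesDecompose ℓ f = ∀ {len ι} → 2 ≤ len → StrictMonoOn ι len → (∀ x → x < len → ι x < ℓ) →
  Decomposable _<_ (f ∘ ι) len

decomposable-shift : ∀ {F G m c} → (∀ x → x < m → F x ≡ G x + c) →
  Decomposable _<_ G m → Decomposable _<_ F m
decomposable-shift {F} {G} {m} {c} F≡G+c (k , 1≤k , k<m , split) =
  k , 1≤k , k<m , Sum.map (λ s x y x<k k≤y y<m → shift (x<m x<k) y<m (s x y x<k k≤y y<m))
                          (λ s x y x<k k≤y y<m → shift y<m (x<m x<k) (s x y x<k k≤y y<m)) split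
  where
  x<m : ∀ {x} → x < k → x < m
  x<m x<k = <-trans x<k k<m
  shift : ∀ {x y} → x < m → y < m → G x < G y → F x < F y
  shift {x} {y} x<m y<m lt = subst₂ _<_ (sym (F≡G+c x x<m)) (sym (F≡G+c y y<m)) (+-monoˡ-< c lt)

splitsAt-∘ : ∀ {R h ℓ s ι len k} → SplitsAt R h ℓ s → (∀ x → x < k → ι x < s) →
  (∀ y → k ≤ y → y < len → s ≤ ι y × ι y < ℓ) → SplitsAt R (h ∘ ι) len k
splitsAt-∘ {ι = ι} split before after x y x<k k≤y y<len =
  split (ι x) (ι y) (before x x<k) (proj₁ (after y k≤y y<len)) (proj₂ (after y k≤y y<len))

sum-subsequencesDecompose : ∀ {m n f g h a b} → SubsequencesDecompose m f → SubsequencesDecompose n g →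
  (∀ x → x < m → h x ≡ f x + a) → (∀ x → m ≤ x → x < m + n → h x ≡ g (x ∸ m) + b) →
  SplitsAt _<_ h (m + n) m ⊎ SplitsAt (flip _<_) h (m + n) m → SubsequencesDecompose (m + n) h
sum-subsequencesDecompose {m} {n} {f} {g} {h} f-dec g-dec left right across {len} {ι} 2≤len mono bnd
  with least-or-none (λ y → m ≤? ι y) len
... | inj₁ allLeft =
  decomposable-shift (λ x x<len → left (ι x) (inLeft x x<len)) (f-dec 2≤len mono inLeft)
  where
  inLeft : ∀ x → x < len → ι x < m
  inLeft x x<len = ≰⇒> (allLeft x x<len)
... | inj₂ (zero , _ , m≤ι0 , _) =
  decomposable-shift (λ x x<len → right (ι x) (inRight x x<len) (bnd x x<len)) (g-dec 2≤len shifted-mono shifted-bounded)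
  where
  inRight : ∀ x → x < len → m ≤ ι x
  inRight x x<len = ≤-trans m≤ι0 (strictMonoOn⇒monoOn mono 0 x z≤n x<len)
  shifted-mono : StrictMonoOn (λ x → ι x ∸ m) len
  shifted-mono a b a<b b<len = ∸-monoˡ-< (mono a b a<b b<len) (inRight a (<-trans a<b b<len))
  shifted-bounded : ∀ x → x < len → ι x ∸ m < n
  shifted-bounded x x<len = m<n+o⇒m∸n<o′ (inRight x x<len) (bnd x x<len)
... | inj₂ (suc k , k<len , m≤ιk , leftBefore) =
  suc k , s≤s z≤n , k<len , Sum.map (cut {_<_}) (cut {flip _<_}) across
  where
  cut : ∀ {R} → SplitsAt R h (m + n) m → SplitsAt R (h ∘ ι) len (suc k)
  cut {R} split = splitsAt-∘ {R} {h} split (λ x x<k → ≰⇒> (leftBefore x x<k))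
    (λ y k≤y y<len → ≤-trans m≤ιk (strictMonoOn⇒monoOn mono _ y k≤y y<len) , bnd y y<len)

separable⇒subsequencesDecompose : ∀ {ℓ f} → Sep ℓ f → SubsequencesDecompose ℓ f
separable⇒subsequencesDecompose (one _) 2≤len mono bnd =
  ⊥-elim (n≮0 (<-≤-trans (mono 0 1 z<s 2≤len) (s≤s⁻¹ (bnd 1 2≤len))))
separable⇒subsequencesDecompose (dsum {m} {n} {f} {g} {h} sf sg left right) =
  sum-subsequencesDecompose {m} {n} {f} {g} {h}
    (separable⇒subsequencesDecompose sf) (separable⇒subsequencesDecompose sg)
    (λ x x<m → trans (left x x<m) (sym (+-identityʳ (f x)))) right (inj₁ across)
  where
  across : SplitsAt _<_ h (m + n) m
  across x y x<m m≤y y<m+n = subst₂ _<_ (sym (left x x<m)) (sym (right y m≤y y<m+n))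
    (<-≤-trans (sep-bounded sf x x<m) (m≤n+m m (g (y ∸ m))))
separable⇒subsequencesDecompose (ssum {m} {n} {f} {g} {h} sf sg left right) =
  sum-subsequencesDecompose {m} {n} {f} {g} {h}
    (separable⇒subsequencesDecompose sf) (separable⇒subsequencesDecompose sg)
    left (λ x m≤x x<m+n → trans (right x m≤x x<m+n) (sym (+-identityʳ (g (x ∸ m))))) (inj₂ across)
  where
  across : SplitsAt (flip _<_) h (m + n) m
  across x y x<m m≤y y<m+n = subst₂ _<_ (sym (right y m≤y y<m+n)) (sym (left x x<m))
    (<-≤-trans (sep-bounded sg (y ∸ m) (m<n+o⇒m∸n<o′ m≤y y<m+n)) (m≤n+m n (f x)))

<ᵇ-true : ∀ {m n} → m < n → (m <ᵇ n) ≡ true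
<ᵇ-true m<n = Equivalence.to T-≡ (<⇒<ᵇ m<n)

<ᵇ-false : ∀ {m n} → ¬ m < n → (m <ᵇ n) ≡ false
<ᵇ-false {m} {n} m≮n with m <ᵇ n | <ᵇ⇒< m n
... | false | _ = refl
... | true | m<n = ⊥-elim (m≮n (m<n _))

≡ᵇ-refl : ∀ n → (n ≡ᵇ n) ≡ true
≡ᵇ-refl n = Equivalence.to T-≡ (≡⇒≡ᵇ n n refl)

≡ᵇ-false : ∀ {m n} → m ≢ n → (m ≡ᵇ n) ≡ false
≡ᵇ-false {m} {n} m≢n with m ≡ᵇ n | ≡ᵇ⇒≡ m n
... | false | _ = refl
... | true | m≡n = ⊥-elim (m≢n (m≡n _))

⌊⌋-yes : ∀ {A : Set} (a? : Dec A) → A → ⌊ a? ⌋ ≡ true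
⌊⌋-yes a? a = trans (isYes≗does a?) (dec-true a? a)

⌊⌋-no : ∀ {A : Set} (a? : Dec A) → ¬ A → ⌊ a? ⌋ ≡ false
⌊⌋-no a? ¬a = trans (isYes≗does a?) (dec-false a? ¬a)

▷-init : ∀ {p c x y} → y < size p → at (p ▷ c) x y ≡ at p x y
▷-init {p} {c} {x} {y} y<p = cong (λ b → if b then c else at p x y) (≡ᵇ-false (<⇒≢ y<p))

▷-last : ∀ {p c x} → at (p ▷ c) x (size p) ≡ c
▷-last {p} {c} {x} = cong (λ b → if b then c else at p x (size p)) (≡ᵇ-refl (size p))

module _ (p q : Pattern) {x y : ℕ} where
  private
    right : Bool
    right = at q (x ∸ (size p ∸ 1)) (y ∸ (size p ∸ 1))

    lower : Bool → Bool
    lower b = if b then right else at p x (size p ∸ 1)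

    join-off : ¬ y < size p → at (join p q) x y ≡ lower ((size p ∸ 1) <ᵇ suc x)
    join-off y≮p = cong (λ b → if b then at p x y else lower ((size p ∸ 1) <ᵇ suc x)) (<ᵇ-false y≮p)

  join-left : y < size p → at (join p q) x y ≡ at p x y
  join-left y<p = cong (λ b → if b then at p x y else lower ((size p ∸ 1) <ᵇ suc x)) (<ᵇ-true y<p)

  join-right : size p ∸ 1 ≤ x → ¬ y < size p → at (join p q) x y ≡ right
  join-right p≤1+x y≮p = trans (join-off y≮p) (cong lower (<ᵇ-true (s≤s p≤1+x)))

  join-cross : x < size p ∸ 1 → ¬ y < size p → at (join p q) x y ≡ at p x (size p ∸ 1)
  join-cross x<p y≮p = trans (join-off y≮p) (cong lower (<ᵇ-false (<⇒≱ x<p ∘ s≤s⁻¹)))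

size-join : ∀ p q → 2 ≤ size q → size p < size (join p q)
size-join p (pat (suc zero) _) (s≤s ())
size-join p (pat (suc (suc m)) _) _ =
  subst (size p <_) (sym (+-∸-assoc (size p) (s≤s z≤n))) (m<m+n (size p) z<s)

CrossConstant : Pattern → ℕ → Bool → Set
CrossConstant q k c = ∀ x y → x < y → y < size q → x < k → k ≤ y → at q x y ≡ c

crossConstant-last⇒convergent : ∀ {k t c} → CrossConstant (pat (suc k) t) k c →
  Convergent (pat (suc k) t)
crossConstant-last⇒convergent {k} {t} {c} constant = pat k t , c , refl , agree
  where
  agree : ∀ x y → x < y → y < suc k → t x y ≡ at (pat k t ▷ c) x y
  agree x y x<y y<1+k with m<1+n⇒m<n∨m≡n y<1+k
  ... | inj₁ y<k = sym (▷-init {pat k t} y<k)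
  ... | inj₂ refl = trans (constant x y x<y y<1+k x<y ≤-refl) (sym (▷-last {pat k t}))

crossConstant⇒reducible : ∀ {n k t c} → 1 ≤ k → k < n → CrossConstant (pat (suc n) t) k c →
  Reducible (pat (suc n) t)
crossConstant⇒reducible {n} {k} {t} {c} 1≤k k<n constant =
  p₀ , p₁ , s≤s 1≤k , s≤s (m<n⇒0<n∸m k<n) , size≡ , agree
  where
  p₀ p₁ : Pattern
  p₀ = pat (suc k) t
  p₁ = pat (suc (n ∸ k)) (λ a b → t (k + a) (k + b))
  size≡ : suc n ≡ k + suc (n ∸ k)
  size≡ = sym (trans (+-suc k (n ∸ k)) (cong suc (m+[n∸m]≡n (<⇒≤ k<n))))
  agree : ∀ x y → x < y → y < suc n → t x y ≡ at (join p₀ p₁) x y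
  agree x y x<y y<1+n with y <? suc k
  ... | yes y≤k = sym (join-left p₀ p₁ y≤k)
  ... | no y≮1+k with x <? k
  ...   | yes x<k = begin
    t x y                  ≡⟨ constant x y x<y y<1+n x<k k≤y ⟩
    c                      ≡⟨ constant x k x<k (m<n⇒m<1+n k<n) x<k ≤-refl ⟨
    t x k                  ≡⟨ join-cross p₀ p₁ x<k y≮1+k ⟨
    at (join p₀ p₁) x y    ∎
    where
    open ≡-Reasoning
    k≤y : k ≤ y
    k≤y = <⇒≤ (≮⇒≥ y≮1+k)
  ...   | no x≮k = trans (cong₂ t (sym (m+[n∸m]≡n (≮⇒≥ x≮k))) (sym (m+[n∸m]≡n (<⇒≤ (≮⇒≥ y≮1+k)))))
                         (sym (join-right p₀ p₁ (≮⇒≥ x≮k) y≮1+k))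

crossConstant⇒convergent⊎reducible : ∀ {n k t c} → 1 ≤ k → k < suc n →
  CrossConstant (pat (suc n) t) k c →
  Convergent (pat (suc n) t) ⊎ Reducible (pat (suc n) t)
crossConstant⇒convergent⊎reducible 1≤k k<1+n constant with m<1+n⇒m<n∨m≡n k<1+n
... | inj₁ k<n = inj₂ (crossConstant⇒reducible 1≤k k<n constant)
... | inj₂ refl = inj₁ (crossConstant-last⇒convergent constant)

-- a convergent pattern has a constant last column; a join with a left part of size 2 or 3
-- repeats the entry (0 , 1) or (0 , 2) further along row 0
diverging-irreducible₄ : ∀ {t} → t 0 1 ≢ t 0 2 → t 0 2 ≢ t 0 3 → t 0 3 ≢ t 1 3 →
  Diverging (pat 4 t) × Irreducible (pat 4 t)
diverging-irreducible₄ {t} t01≢t02 t02≢t03 t03≢t13 = diverging , irreducible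
  where
  0<2 : 0 < 2
  0<2 = z<s
  0<3 : 0 < 3
  0<3 = z<s
  1<3 : 1 < 3
  1<3 = s<s z<s
  1<4 : 1 < 4
  1<4 = s<s z<s
  2<4 : 2 < 4
  2<4 = s<s 1<3
  3<4 : 3 < 4
  3<4 = n<1+n 3

  diverging : Diverging (pat 4 t)
  diverging (pat .3 _ , _ , refl , agree) = t03≢t13 (trans (agree 0 3 0<3 3<4) (sym (agree 1 3 1<3 3<4)))

  irreducible : Irreducible (pat 4 t)
  irreducible (pat 1 _ , _ , s≤s () , _)
  irreducible (pat 2 _ , _ , _ , _ , _ , agree) =
    t01≢t02 (trans (agree 0 1 z<s 1<4) (sym (agree 0 2 0<2 2<4)))
  irreducible (pat 3 _ , _ , _ , _ , _ , agree) =
    t02≢t03 (trans (agree 0 2 0<2 2<4) (sym (agree 0 3 0<3 3<4)))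
  irreducible (p₀@(pat (suc (suc (suc (suc _)))) _) , p₁ , _ , 2≤p₁ , size≡ , _) =
    <-irrefl refl (≤-<-trans (s≤s (s≤s (s≤s (s≤s z≤n))))
                             (subst (size p₀ <_) (sym size≡) (size-join p₀ p₁ 2≤p₁)))

permFun-at : ∀ {ℓ} (π : Permutation′ ℓ) {x} (x<ℓ : x < ℓ) → permFun π x ≡ toℕ (π ⟨$⟩ʳ fromℕ< x<ℓ)
permFun-at {ℓ} π {x} x<ℓ with x <? ℓ
... | yes _ = refl
... | no x≮ℓ = ⊥-elim (x≮ℓ x<ℓ)

permFun-isPermutation : ∀ {ℓ} (π : Permutation′ ℓ) → IsPermutationOn ℓ (permFun π)
permFun-isPermutation {ℓ} π = record { bounded = bounded ; injective = injective }
  where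
  bounded : ∀ x → x < ℓ → permFun π x < ℓ
  bounded x x<ℓ rewrite permFun-at π x<ℓ = Fin.toℕ<n _
  injective : InjectiveOn (permFun π) ℓ
  injective x y x<ℓ y<ℓ e rewrite permFun-at π x<ℓ | permFun-at π y<ℓ =
    Fin.fromℕ<-injective x y x<ℓ y<ℓ (begin
      fromℕ< x<ℓ                        ≡⟨ inverseˡ π ⟨
      π ⟨$⟩ˡ (π ⟨$⟩ʳ fromℕ< x<ℓ)        ≡⟨ cong (π ⟨$⟩ˡ_) (Fin.toℕ-injective e) ⟩
      π ⟨$⟩ˡ (π ⟨$⟩ʳ fromℕ< y<ℓ)        ≡⟨ inverseˡ π ⟩
      fromℕ< y<ℓ                        ∎)
    where open ≡-Reasoning

permPat-at : ∀ {ℓ} (π : Permutation′ ℓ) {x y} → x < ℓ → y < ℓ →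
  at (permPat π) x y ≡ not ⌊ permFun π x <? permFun π y ⌋
permPat-at {ℓ} π {x} {y} x<ℓ y<ℓ with x <? ℓ | y <? ℓ
... | yes _ | yes _ = refl
... | no x≮ℓ | _ = ⊥-elim (x≮ℓ x<ℓ)
... | yes _ | no y≮ℓ = ⊥-elim (y≮ℓ y<ℓ)

permPat-ascent : ∀ {ℓ} (π : Permutation′ ℓ) {x y} → x < ℓ → y < ℓ → permFun π x < permFun π y →
  at (permPat π) x y ≡ false
permPat-ascent π {x} {y} x<ℓ y<ℓ lt =
  trans (permPat-at π x<ℓ y<ℓ) (cong not (⌊⌋-yes (permFun π x <? permFun π y) lt))

permPat-descent : ∀ {ℓ} (π : Permutation′ ℓ) {x y} → x < ℓ → y < ℓ → permFun π y < permFun π x →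
  at (permPat π) x y ≡ true
permPat-descent π {x} {y} x<ℓ y<ℓ gt =
  trans (permPat-at π x<ℓ y<ℓ) (cong not (⌊⌋-no (permFun π x <? permFun π y) (<⇒≯ gt)))

subpattern-crossConstant : ∀ {ℓ} (π : Permutation′ ℓ) → Separable π → ∀ {q} → 2 ≤ size q →
  SubPattern q (permPat π) → ∃ λ k → ∃ λ c → 1 ≤ k × k < size q × CrossConstant q k c
subpattern-crossConstant π sep 2≤q (ι , mono , bnd , _ , agree)
  with separable⇒subsequencesDecompose sep 2≤q mono bnd
... | k , 1≤k , k<q , inj₁ ascending = k , false , 1≤k , k<q , λ x y x<y y<q x<k k≤y →
  trans (agree x y x<y y<q)
        (permPat-ascent π (bnd x (<-trans x<y y<q)) (bnd y y<q) (ascending x y x<k k≤y y<q))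
... | k , 1≤k , k<q , inj₂ descending = k , true , 1≤k , k<q , λ x y x<y y<q x<k k≤y →
  trans (agree x y x<y y<q)
        (permPat-descent π (bnd x (<-trans x<y y<q)) (bnd y y<q) (descending x y x<k k≤y y<q))

subpattern-convergent⊎reducible : ∀ {ℓ} (π : Permutation′ ℓ) → Separable π → ∀ {q} → 1 ≤ size q →
  SubPattern q (permPat π) → Convergent q ⊎ Reducible q
subpattern-convergent⊎reducible π sep {pat 1 t} _ _ =
  inj₁ (crossConstant-last⇒convergent {0} {t} {true} λ _ _ _ _ ())
subpattern-convergent⊎reducible π sep {pat (suc (suc n)) t} _ sub
  with subpattern-crossConstant π sep (s≤s (s≤s z≤n)) sub
... | k , c , 1≤k , k<q , constant = crossConstant⇒convergent⊎reducible 1≤k k<q constant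

select4 : ℕ → ℕ → ℕ → ℕ → ℕ → ℕ
select4 a b c d 0 = a
select4 a b c d 1 = b
select4 a b c d 2 = c
select4 a b c d (suc (suc (suc _))) = d

select4-strictMono : ∀ {a b c d} → a < b → b < c → c < d → StrictMonoOn (select4 a b c d) 4
select4-strictMono {a} {b} {c} {d} a<b b<c c<d = strictMonoOn-suc step
  where
  step : ∀ i → suc i < 4 → select4 a b c d i < select4 a b c d (suc i)
  step 0 _ = a<b
  step 1 _ = b<c
  step 2 _ = c<d
  step (suc (suc (suc _))) (s≤s (s≤s (s≤s (s≤s ()))))

select4-bounded : ∀ {a b c d ℓ} → a < b → b < c → c < d → d < ℓ → ∀ i → select4 a b c d i < ℓ
select4-bounded a<b b<c c<d d<ℓ 0 = <-trans a<b (<-trans b<c (<-trans c<d d<ℓ))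
select4-bounded a<b b<c c<d d<ℓ 1 = <-trans b<c (<-trans c<d d<ℓ)
select4-bounded a<b b<c c<d d<ℓ 2 = <-trans c<d d<ℓ
select4-bounded a<b b<c c<d d<ℓ (suc (suc (suc _))) = d<ℓ

Opposes : (ℕ → ℕ → Set) → Set
Opposes R = ∀ {u w u′ w′} → R u w → R w′ u′ → ⌊ u <? w ⌋ ≢ ⌊ u′ <? w′ ⌋

<-opposes : Opposes _<_
<-opposes {u} {w} {u′} {w′} u<w w′<u′ e
  with trans (sym (⌊⌋-yes (u <? w) u<w)) (trans e (⌊⌋-no (u′ <? w′) (<⇒≯ w′<u′)))
... | ()

>-opposes : Opposes (flip _<_)
>-opposes w<u u′<w′ e = <-opposes u′<w′ w<u (sym e)

occurs3142⇒subpattern : ∀ {ℓ R} (π : Permutation′ ℓ) → Transitive R → Opposes R →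
  Occurs3142 R (permFun π) ℓ →
  Σ Pattern λ q → 1 ≤ size q × SubPattern q (permPat π) × Diverging q × Irreducible q
occurs3142⇒subpattern {ℓ} {R} π R-trans opposes (a , b , c , d , a<b , b<c , c<d , d<ℓ , bd , da , ac) =
  pat 4 t , z<s , (ι , select4-strictMono a<b b<c c<d , (λ i _ → bounded i) , refl , λ _ _ _ _ → refl) ,
  diverging-irreducible₄ (≢-sym (differ {0} {2} {0} {1} ac (R-trans bd da)))
                         (differ {0} {2} {0} {3} ac da) (≢-sym (differ {1} {3} {0} {3} bd da))
  where
  ι : ℕ → ℕ
  ι = select4 a b c d
  bounded : ∀ i → ι i < ℓ
  bounded = select4-bounded a<b b<c c<d d<ℓ
  v : ℕ → ℕ
  v = permFun π
  t : ℕ → ℕ → Bool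
  t i j = at (permPat π) (ι i) (ι j)
  entry : ∀ i j → t i j ≡ not ⌊ v (ι i) <? v (ι j) ⌋
  entry i j = permPat-at π (bounded i) (bounded j)
  differ : ∀ {i j i′ j′} → R (v (ι i)) (v (ι j)) → R (v (ι j′)) (v (ι i′)) → t i j ≢ t i′ j′
  differ {i} {j} {i′} {j′} r r′ e =
    opposes r r′ (not-injective (trans (sym (entry i j)) (trans e (entry i′ j′))))

proposition2p7 : (n : ℕ) (π : Permutation′ (suc n)) →
    Separable π ⇔
      (¬ Σ Pattern (λ q → 1 ≤ size q × SubPattern q (permPat π) × Diverging q × Irreducible q))
proposition2p7 n π = mk⇔ forward backward
  where
  BadSubpattern : Set
  BadSubpattern = Σ Pattern (λ q → 1 ≤ size q × SubPattern q (permPat π) × Diverging q × Irreducible q)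
  forward : Separable π → ¬ BadSubpattern
  forward sep (q , 1≤q , sub , diverging , irreducible) =
    [ diverging , irreducible ]′ (subpattern-convergent⊎reducible π sep 1≤q sub)
  backward : ¬ BadSubpattern → Separable π
  backward avoids with separable-or-contains (<-wellFounded (suc n)) (s≤s z≤n) (permFun-isPermutation π)
  ... | inj₁ sep = sep
  ... | inj₂ (inj₁ occurs) = ⊥-elim (avoids (occurs3142⇒subpattern π <-trans <-opposes occurs))
  ... | inj₂ (inj₂ occurs) = ⊥-elim (avoids (occurs3142⇒subpattern π (flip <-trans) >-opposes occurs))
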